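{- Let $p\ge5$ be a prime and $e\ge1$. For every $j\in\mathbb Z_{p^e(p-1)}^*$, the map $\mathcal M_1(p,e,j)$ is chiral, and it has type $\{p^e(p-1),p^e(p-1)\}$ if $p\equiv1\pmod4$ and type $\{\frac{p^e(p-1)}2,p^e(p-1)\}$ if $p\equiv3\pmod4$.
   Context: $G_1(p,e)=\langle a,c\mid a^{p^e(p-1)}=c^{p^{e+1}}=1,\ c^a=c^r\rangle$ with $r$ a fixed generator of $\mathbb Z_{p^{e+1}}^*$ (with $c^a=a^{ -1}ca$), and $\mathcal M_1(p,e,j)=\mathcal M(G_1(p,e);a^j,b)$ where $b=a^{p^e(p-1)/2}c$ is an involution. For a group $G=\langle a,b\rangle$ with $b$ an involution and $\langle a\rangle$ core-free, $\mathcal M(G;a,b)$ is the orientably-regular map on the coset graph with vertices $\{\langle a\rangle g\}$, arcs $\{(\langle a\rangle g,\langle a\rangle bg)\}$ and local rotation $(\langle a\rangle g,\langle a\rangle bg)\mapsto(\langle a\rangle g,\langle a\rangle bag)$. $\mathcal M(G;a,b)\cong\mathcal M(G;a',b')$ iff some automorphism of $G$ maps $a\mapsto a'$, $b\mapsto b'$. The map has type $\{s,t\}$ with $s$ the order of $ab$ and $t$ the order of $a$; it is reflexible if $\mathcal M(G;a,b)\cong\mathcal M(G;a^{ -1},b)$ and chiral otherwise. -}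

module Defs where

open import Data.Nat using (ℕ; zero; suc; _+_; _*_; _∸_; _^_; _≤_; _<_; z≤n; s≤s; NonZero)
open import Data.Nat.Properties using (m*n≢0; m^n≢0)
open import Data.Nat.DivMod using (_mod_; _%_; _/_)
open import Data.Nat.Coprimality using (Coprime)
open import Data.Fin using (Fin; toℕ)
open import Data.Product using (Σ; _×_; _,_; ∃)
open import Relation.Binary.PropositionalEquality using (_≡_)
open import Relation.Nullary using (¬_)
open import Function.Definitions using (Bijective)

-- |a| = p^e (p-1)  and  |c| = p^(e+1)
N : ℕ → ℕ → ℕ
N p e = p ^ e * (p ∸ 1)

M : ℕ → ℕ → ℕ
M p e = p ^ suc e

nzN : ∀ {p} e → 2 ≤ p → NonZero (N p e)
nzN {suc (suc k)} e (s≤s (s≤s z≤n)) = m*n≢0 (suc (suc k) ^ e) (suc k) {{m^n≢0 (suc (suc k)) e}}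

nzM : ∀ {p} e → 2 ≤ p → NonZero (M p e)
nzM {suc (suc k)} e (s≤s (s≤s z≤n)) = m^n≢0 (suc (suc k)) (suc e)

IsGenerator : (r m : ℕ) .{{_ : NonZero m}} → Set
IsGenerator r m = Coprime r m × (∀ x → Coprime x m → ∃ λ t → (r ^ t) % m ≡ x % m)

-- Concrete model of the metacyclic group <a,c | a^n = c^m = 1, c^a = c^r>:
-- the pair (i , k) stands for the normal form a^i c^k.  Since c a = a c^r,
-- (a^i c^k)(a^i' c^k') = a^(i+i') c^(k r^i' + k').
module Meta (n m r : ℕ) .{{_ : NonZero n}} .{{_ : NonZero m}} where

  El : Set
  El = Fin n × Fin m

  _·_ : El → El → El
  (i , k) · (i' , k') = ((toℕ i + toℕ i') mod n , (toℕ k * r ^ toℕ i' + toℕ k') mod m)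

  one : El
  one = (0 mod n , 0 mod m)

  pow : El → ℕ → El
  pow x zero = one
  pow x (suc t) = x · pow x t

  a : El
  a = (1 mod n , 0 mod m)

  c : El
  c = (0 mod n , 1 mod m)

  IsOrder : El → ℕ → Set
  IsOrder x t = 0 < t × pow x t ≡ one × (∀ u → 0 < u → pow x u ≡ one → t ≤ u)

  IsAut : (El → El) → Set
  IsAut φ = Bijective _≡_ _≡_ φ × (∀ x y → φ (x · y) ≡ φ x · φ y)

  -- M(G;x,y) ≅ M(G;x',y')  iff  some automorphism maps x ↦ x', y ↦ y'
  MapIso : El → El → El → El → Set
  MapIso x y x' y' = Σ (El → El) λ φ → IsAut φ × φ x ≡ x' × φ y ≡ y'

  HasType : El → El → ℕ → ℕ → Set
  HasType x y s t = IsOrder (x · y) s × IsOrder x t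

module G1 (p e r : ℕ) (h : 2 ≤ p) where
  open Meta (N p e) (M p e) r {{nzN e h}} {{nzM e h}} public
  b : El
  b = pow a (N p e / 2) · c

{-# OPTIONS --safe #-}
-- Write n = p^e (p-1), m = p^(e+1) and n₂ = n/2.  Fermat's little theorem, lifted
-- along p-powers, gives r^n ≡ 1 (mod m); hence in the normal form a^i c^k the
-- exponents i, k may be read modulo n, m and (a^i c^k)(a^i' c^k') = a^(i+i') c^(k r^i' + k').
-- So a^j b = a^(j+n₂) c, and (a^I c)^u = a^(uI) c^(1 + r^I + ... + r^((u-1)I)).
-- As r generates (ℤ/m)*, r² ≢ 1 (mod p): otherwise every power of r would be ≡ 1 or r,
-- yet 2 and 3 are both powers.  Since gcd(j+n₂, n) divides 2, also r^(j+n₂) ≢ 1 (mod p),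
-- so r^(j+n₂) - 1 is a unit mod m and the geometric sum above vanishes as soon as
-- n ∣ u(j+n₂).  The order of a^j b is therefore the additive order of j+n₂ modulo n:
-- n when n₂ is even (p ≡ 1 mod 4) and n₂ when n₂ is odd (p ≡ 3 mod 4).
-- An automorphism with a^j ↦ a^(-j), b ↦ b sends a to a⁻¹ and fixes c = a^n₂ b; applied
-- to c a = a c^r it gives r^(n-1) ≡ r, i.e. r² ≡ 1 (mod m), which is impossible.

module Submission where

open import Defs
open import Data.Nat using (ℕ; _≤_; _<_; _∸_; _/_; _%_; s≤s; z≤n)
open import Data.Nat.Properties using (≤-trans)
open import Data.Nat.Primality using (Prime)
open import Data.Nat.Coprimality using (Coprime)
open import Data.Product using (_×_)
open import Relation.Binary.PropositionalEquality using (_≡_)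
open import Relation.Nullary using (¬_)

open import Data.Nat
open import Data.Nat.Properties
open import Data.Nat.DivMod
open import Data.Nat.Divisibility
open import Data.Nat.Primality
open import Data.Nat.Coprimality using (coprime-divisor; prime⇒coprime)
import Data.Nat.Coprimality as Coprime
open import Data.Nat.GCD using (gcd; gcd-GCD; gcd[m,n]∣m; gcd[m,n]∣n; module Bézout)
open import Data.Nat.Combinatorics using (_C_; nCk≡n!/k![n-k]!; k![n∸k]!∣n!; nCn≡1)
open import Data.Fin using (Fin; zero; suc; toℕ; fromℕ; inject₁)
open import Data.Fin.Properties using (toℕ-fromℕ; toℕ-inject₁; toℕ<n; toℕ-fromℕ<; fromℕ<-cong; fromℕ<-toℕ)
open import Data.Product using (∃; _,_; proj₁; proj₂)
open import Data.Sum using (_⊎_; inj₁; inj₂)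
open import Data.Empty using (⊥-elim)
open import Function using (_∘_; _⇔_; mk⇔; Equivalence)
open import Function.Construct.Composition using (_⇔-∘_)
open import Relation.Binary.Bundles using (Setoid)
open import Relation.Binary.PropositionalEquality
import Relation.Binary.Reasoning.Setoid as SetoidReasoning
import Algebra.Properties.CommutativeSemiring.Binomial as Binomial
import Algebra.Properties.Monoid.Sum +-0-monoid as Sum
import Algebra.Properties.Semiring.Exp as SemiringExp
import Algebra.Definitions.RawMonoid as RawMonoid
open import Data.Nat.Tactic.RingSolver using (solve-∀)

infix 4 _≡_[mod_]

-- Congruence by explicit multiples rather than via _%_: it needs no NonZero q instance,
-- and being a record it lets Agda infer x, y and q from a proof.
record _≡_[mod_] (x y q : ℕ) : Set where
  constructor congruent
  field
    k₁ k₂   : ℕ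
    witness : x + k₁ * q ≡ y + k₂ * q

module _ {q : ℕ} where

  ≡-mod-reflexive : ∀ {x y} → x ≡ y → x ≡ y [mod q ]
  ≡-mod-reflexive x≡y = congruent 0 0 (cong (_+ 0) x≡y)

  ≡-mod-sym : ∀ {x y} → x ≡ y [mod q ] → y ≡ x [mod q ]
  ≡-mod-sym (congruent a b e) = congruent b a (sym e)

  ≡-mod-trans : ∀ {x y z} → x ≡ y [mod q ] → y ≡ z [mod q ] → x ≡ z [mod q ]
  ≡-mod-trans {x} {y} {z} (congruent a b x≡y) (congruent c d y≡z) = congruent (a + c) (d + b) (begin
    x + (a + c) * q       ≡⟨ regroup x a c q ⟩
    (x + a * q) + c * q   ≡⟨ cong (_+ c * q) x≡y ⟩
    (y + b * q) + c * q   ≡⟨ swap y b c q ⟩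
    (y + c * q) + b * q   ≡⟨ cong (_+ b * q) y≡z ⟩
    (z + d * q) + b * q   ≡⟨ regroup z d b q ⟨
    z + (d + b) * q       ∎)
    where
    open ≡-Reasoning
    regroup : ∀ u s t q → u + (s + t) * q ≡ (u + s * q) + t * q
    regroup = solve-∀
    swap : ∀ u s t q → (u + s * q) + t * q ≡ (u + t * q) + s * q
    swap = solve-∀

≡-mod-setoid : ℕ → Setoid _ _
≡-mod-setoid q = record
  { _≈_           = _≡_[mod q ]
  ; isEquivalence = record { refl = ≡-mod-reflexive refl ; sym = ≡-mod-sym ; trans = ≡-mod-trans }
  }

module ≡-mod-Reasoning (q : ℕ) = SetoidReasoning (≡-mod-setoid q)

module _ {q : ℕ} where

  +-cong-mod : ∀ {x y u v} → x ≡ y [mod q ] → u ≡ v [mod q ] → x + u ≡ y + v [mod q ]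
  +-cong-mod {x} {y} {u} {v} (congruent a b x≡y) (congruent c d u≡v) = congruent (a + c) (b + d) (begin
    x + u + (a + c) * q            ≡⟨ interchange x u a c q ⟩
    (x + a * q) + (u + c * q)      ≡⟨ cong₂ _+_ x≡y u≡v ⟩
    (y + b * q) + (v + d * q)      ≡⟨ interchange y v b d q ⟨
    y + v + (b + d) * q            ∎)
    where
    open ≡-Reasoning
    interchange : ∀ x u a c q → x + u + (a + c) * q ≡ (x + a * q) + (u + c * q)
    interchange = solve-∀

  *-cong-mod : ∀ {x y u v} → x ≡ y [mod q ] → u ≡ v [mod q ] → x * u ≡ y * v [mod q ]
  *-cong-mod {x} {y} {u} {v} (congruent a b x≡y) (congruent c d u≡v) =
    congruent (a * (u + c * q) + x * c) (b * (v + d * q) + y * d) (begin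
    x * u + (a * (u + c * q) + x * c) * q   ≡⟨ expand x u a c q ⟩
    (x + a * q) * (u + c * q)               ≡⟨ cong₂ _*_ x≡y u≡v ⟩
    (y + b * q) * (v + d * q)               ≡⟨ expand y v b d q ⟨
    y * v + (b * (v + d * q) + y * d) * q   ∎)
    where
    open ≡-Reasoning
    expand : ∀ x u a c q → x * u + (a * (u + c * q) + x * c) * q ≡ (x + a * q) * (u + c * q)
    expand = solve-∀

  ^-congˡ-mod : ∀ {x y} → x ≡ y [mod q ] → ∀ k → x ^ k ≡ y ^ k [mod q ]
  ^-congˡ-mod x≡y zero    = ≡-mod-reflexive refl
  ^-congˡ-mod x≡y (suc k) = *-cong-mod x≡y (^-congˡ-mod x≡y k)

  ≡1⇒^≡1 : ∀ {x} → x ≡ 1 [mod q ] → ∀ k → x ^ k ≡ 1 [mod q ]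
  ≡1⇒^≡1 x≡1 k = ≡-mod-trans (^-congˡ-mod x≡1 k) (≡-mod-reflexive (^-zeroˡ k))

  ∣⇒+-≡-mod : ∀ x {y} → q ∣ y → x + y ≡ x [mod q ]
  ∣⇒+-≡-mod x {y} (divides t y≡tq) = congruent 0 t (trans (+-identityʳ (x + y)) (cong (x +_) y≡tq))

  ∣⇒≡0-mod : ∀ {x} → q ∣ x → x ≡ 0 [mod q ]
  ∣⇒≡0-mod = ∣⇒+-≡-mod 0

  ≡-mod⇒∣∸ : ∀ {x y} → x ≡ y [mod q ] → q ∣ x ∸ y
  ≡-mod⇒∣∸ {x} {y} (congruent a b x≡y) = divides (b ∸ a) (begin
    x ∸ y                         ≡⟨ [m+n]∸[m+o]≡n∸o (a * q) x y ⟨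
    a * q + x ∸ (a * q + y)       ≡⟨ cong₂ _∸_ (trans (+-comm (a * q) x) x≡y) (+-comm (a * q) y) ⟩
    y + b * q ∸ (y + a * q)       ≡⟨ [m+n]∸[m+o]≡n∸o y (b * q) (a * q) ⟩
    b * q ∸ a * q                 ≡⟨ *-distribʳ-∸ q b a ⟨
    (b ∸ a) * q                   ∎)
    where open ≡-Reasoning

  ≡0-mod⇒∣ : ∀ {x} → x ≡ 0 [mod q ] → q ∣ x
  ≡0-mod⇒∣ = ≡-mod⇒∣∸

  +-cancelˡ-≡-mod : ∀ x {y} → x + y ≡ x [mod q ] → q ∣ y
  +-cancelˡ-≡-mod x {y} eq = subst (q ∣_) (m+n∸m≡n x y) (≡-mod⇒∣∸ eq)

  ≡-mod-divisor : ∀ {d x y} → d ∣ q → x ≡ y [mod q ] → x ≡ y [mod d ]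
  ≡-mod-divisor {d} {x} {y} (divides t q≡td) (congruent a b x≡y) =
    congruent (a * t) (b * t) (trans (cong (x +_) (scale a)) (trans x≡y (cong (y +_) (sym (scale b)))))
    where
    scale : ∀ s → s * t * d ≡ s * q
    scale s = trans (*-assoc s t d) (cong (s *_) (sym q≡td))

  module _ .{{_ : NonZero q}} where

    %-≡-mod : ∀ x → x % q ≡ x [mod q ]
    %-≡-mod x = congruent (x / q) 0 (trans (sym (m≡m%n+[m/n]*n x q)) (sym (+-identityʳ x)))

    ≡-mod⇒%≡% : ∀ {x y} → x ≡ y [mod q ] → x % q ≡ y % q
    ≡-mod⇒%≡% {x} {y} (congruent a b x≡y) = begin
      x % q             ≡⟨ [m+kn]%n≡m%n x a q ⟨
      (x + a * q) % q   ≡⟨ cong (_% q) x≡y ⟩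
      (y + b * q) % q   ≡⟨ [m+kn]%n≡m%n y b q ⟩
      y % q             ∎
      where open ≡-Reasoning

    %≡%⇒≡-mod : ∀ {x y} → x % q ≡ y % q → x ≡ y [mod q ]
    %≡%⇒≡-mod {x} {y} e = ≡-mod-trans (≡-mod-sym (%-≡-mod x)) (≡-mod-trans (≡-mod-reflexive e) (%-≡-mod y))

geometricSum : ℕ → ℕ → ℕ
geometricSum g zero    = 0
geometricSum g (suc t) = g ^ t + geometricSum g t

suc^≡1+*geometricSum : ∀ h t → suc h ^ t ≡ suc (h * geometricSum (suc h) t)
suc^≡1+*geometricSum h zero    = cong suc (sym (*-zeroʳ h))
suc^≡1+*geometricSum h (suc t) = begin
  suc h ^ t + h * suc h ^ t           ≡⟨ cong (_+ h * suc h ^ t) (suc^≡1+*geometricSum h t) ⟩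
  suc (h * G + h * suc h ^ t)         ≡⟨ cong suc (+-comm (h * G) _) ⟩
  suc (h * suc h ^ t + h * G)         ≡⟨ cong suc (*-distribˡ-+ h (suc h ^ t) G) ⟨
  suc (h * (suc h ^ t + G))           ∎
  where
  open ≡-Reasoning
  G = geometricSum (suc h) t

geometricSum[1,t]≡t : ∀ t → geometricSum 1 t ≡ t
geometricSum[1,t]≡t zero    = refl
geometricSum[1,t]≡t (suc t) = cong₂ _+_ (^-zeroˡ t) (geometricSum[1,t]≡t t)

geometricSum-≡-mod : ∀ {q g} → g ≡ 1 [mod q ] → ∀ t → geometricSum g t ≡ t [mod q ]
geometricSum-≡-mod g≡1 zero    = ≡-mod-reflexive refl
geometricSum-≡-mod g≡1 (suc t) = +-cong-mod (≡1⇒^≡1 g≡1 t) (geometricSum-≡-mod g≡1 t)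

sum-≡-mod-last : ∀ {q} k (g : Fin (suc k) → ℕ) →
                 (∀ i → g (inject₁ i) ≡ 0 [mod q ]) → Sum.sum g ≡ g (fromℕ k) [mod q ]
sum-≡-mod-last zero    g _    = ≡-mod-reflexive (+-identityʳ (g zero))
sum-≡-mod-last (suc k) g init≡0 =
  +-cong-mod (init≡0 zero) (sum-≡-mod-last k (g ∘ suc) (init≡0 ∘ suc))

module ℕ-Binomial = Binomial +-*-commutativeSemiring
open SemiringExp +-*-semiring using () renaming (_^_ to _^ₛ_)
open RawMonoid +-0-rawMonoid using () renaming (_×_ to _×ₛ_)

^-semiring≡^ : ∀ x k → x ^ₛ k ≡ x ^ k
^-semiring≡^ x zero    = refl
^-semiring≡^ x (suc k) = cong (x *_) (^-semiring≡^ x k)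

×-semiring≡* : ∀ k x → k ×ₛ x ≡ k * x
×-semiring≡* zero    x = refl
×-semiring≡* (suc k) x = cong (x +_) (×-semiring≡* k x)

binomialTerm[x,1]≡ : ∀ n x k → ℕ-Binomial.binomialTerm x 1 n k ≡ (n C toℕ k) * x ^ toℕ k
binomialTerm[x,1]≡ n x k = trans (×-semiring≡* (n C toℕ k) _) (cong ((n C toℕ k) *_) (begin
  x ^ₛ toℕ k * 1 ^ₛ (n ∸ toℕ k)  ≡⟨ cong₂ _*_ (^-semiring≡^ x (toℕ k)) (^-semiring≡^ 1 (n ∸ toℕ k)) ⟩
  x ^ toℕ k * 1 ^ (n ∸ toℕ k)    ≡⟨ cong (x ^ toℕ k *_) (^-zeroˡ (n ∸ toℕ k)) ⟩
  x ^ toℕ k * 1                  ≡⟨ *-identityʳ (x ^ toℕ k) ⟩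
  x ^ toℕ k                      ∎))
  where open ≡-Reasoning

[x+1]^[1+n]≡x^[1+n]+1 : ∀ {q} n → (∀ {k} → 0 < k → k < suc n → q ∣ suc n C k) →
                ∀ x → (x + 1) ^ suc n ≡ x ^ suc n + 1 [mod q ]
[x+1]^[1+n]≡x^[1+n]+1 {q} n q∣middle x = begin
  (x + 1) ^ suc n                      ≡⟨ ^-semiring≡^ (x + 1) (suc n) ⟨
  (x + 1) ^ₛ suc n                     ≡⟨ ℕ-Binomial.theorem (suc n) x 1 ⟩
  term zero + Sum.sum (term ∘ suc)     ≈⟨ +-cong-mod (≡-mod-reflexive refl) (sum-≡-mod-last n (term ∘ suc) middle≡0) ⟩
  term zero + term (fromℕ (suc n))     ≡⟨ cong₂ _+_ (binomialTerm[x,1]≡ (suc n) x zero)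
                                                   (binomialTerm[x,1]≡ (suc n) x (fromℕ (suc n))) ⟩
  1 + (suc n C toℕ (fromℕ (suc n))) * x ^ toℕ (fromℕ (suc n))
                                       ≡⟨ cong (λ k → 1 + (suc n C k) * x ^ k) (toℕ-fromℕ (suc n)) ⟩
  1 + (suc n C suc n) * x ^ suc n      ≡⟨ cong (λ c → 1 + c * x ^ suc n) (nCn≡1 (suc n)) ⟩
  1 + 1 * x ^ suc n                    ≡⟨ +-comm 1 (1 * x ^ suc n) ⟩
  1 * x ^ suc n + 1                    ≡⟨ cong (_+ 1) (*-identityˡ (x ^ suc n)) ⟩
  x ^ suc n + 1                        ∎
  where
  open ≡-mod-Reasoning q
  term = ℕ-Binomial.binomialTerm x 1 (suc n)
  middle≡0 : ∀ i → term (suc (inject₁ i)) ≡ 0 [mod q ]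
  middle≡0 i = ≡-mod-trans (≡-mod-reflexive (binomialTerm[x,1]≡ (suc n) x (suc (inject₁ i))))
    (∣⇒≡0-mod (∣m⇒∣m*n _ (q∣middle (s≤s z≤n) (s≤s (subst (_< n) (sym (toℕ-inject₁ i)) (toℕ<n i))))))

module _ {q r : ℕ} where

  ^-≡1-linear : ∀ {d s t u v} → d + s * u ≡ t * v → r ^ u ≡ 1 [mod q ] → r ^ v ≡ 1 [mod q ] → r ^ d ≡ 1 [mod q ]
  ^-≡1-linear {d} {s} {t} {u} {v} d+su≡tv rᵘ≡1 rᵛ≡1 = begin
    r ^ d                  ≡⟨ *-identityʳ (r ^ d) ⟨
    r ^ d * 1              ≈⟨ *-cong-mod {x = r ^ d} (≡-mod-reflexive refl) (≡1⇒^≡1 rᵘ≡1 s) ⟨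
    r ^ d * (r ^ u) ^ s    ≡⟨ cong (r ^ d *_) (^-*-assoc r u s) ⟩
    r ^ d * r ^ (u * s)    ≡⟨ ^-distribˡ-+-* r d (u * s) ⟨
    r ^ (d + u * s)        ≡⟨ cong (λ k → r ^ (d + k)) (*-comm u s) ⟩
    r ^ (d + s * u)        ≡⟨ cong (r ^_) (trans d+su≡tv (*-comm t v)) ⟩
    r ^ (v * t)            ≡⟨ ^-*-assoc r v t ⟨
    (r ^ v) ^ t            ≈⟨ ≡1⇒^≡1 rᵛ≡1 t ⟩
    1                      ∎
    where open ≡-mod-Reasoning q

  ^-≡1-gcd : ∀ {A B} → r ^ A ≡ 1 [mod q ] → r ^ B ≡ 1 [mod q ] → r ^ gcd A B ≡ 1 [mod q ]
  ^-≡1-gcd {A} {B} rᴬ≡1 rᴮ≡1 with Bézout.identity (gcd-GCD A B)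
  ... | Bézout.+- x y eq = ^-≡1-linear {s = y} {x} eq rᴮ≡1 rᴬ≡1
  ... | Bézout.-+ x y eq = ^-≡1-linear {s = x} {y} eq rᴬ≡1 rᴮ≡1

inverse-mod : ∀ {j} n → Coprime j n → ∃ λ k → k * j ≡ 1 [mod n ]
inverse-mod {j} zero    j⊥0 = 1 , ≡-mod-reflexive (trans (+-identityʳ j) (j⊥0 (∣-refl , j ∣0)))
inverse-mod {j} (suc n) j⊥n with Coprime.coprime-Bézout j⊥n
... | Bézout.+- x y eq = x , congruent 0 y (trans (+-identityʳ (x * j)) (sym eq))
... | Bézout.-+ x y eq = n * x , congruent y (x * j) (begin
  n * x * j + y * suc n       ≡⟨ cong (n * x * j +_) eq ⟨
  n * x * j + (1 + x * j)     ≡⟨ rearrange n x j ⟩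
  1 + x * j * suc n           ∎)
  where
  open ≡-Reasoning
  rearrange : ∀ n x j → n * x * j + (1 + x * j) ≡ 1 + x * j * suc n
  rearrange = solve-∀

coprime-^ʳ : ∀ {x p} → Coprime x p → ∀ k → Coprime x (p ^ k)
coprime-^ʳ x⊥p zero    (_ , d∣1) = ∣1⇒≡1 d∣1
coprime-^ʳ x⊥p (suc k) {d} (d∣x , d∣p*pᵏ) = coprime-^ʳ x⊥p k (d∣x , coprime-divisor d⊥p d∣p*pᵏ)
  where
  d⊥p : Coprime d _
  d⊥p (i∣d , i∣p) = x⊥p (∣-trans i∣d d∣x , i∣p)

prime∤⇒coprime : ∀ {p x} → Prime p → ¬ p ∣ x → Coprime x p
prime∤⇒coprime p-prime p∤x (i∣x , i∣p) with prime⇒irreducible p-prime i∣p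
... | inj₁ i≡1 = i≡1
... | inj₂ refl = ⊥-elim (p∤x i∣x)

n∣n! : ∀ n .{{_ : NonZero n}} → n ∣ n !
n∣n! (suc n) = m∣m*n (n !)

module _ {p : ℕ} (p-prime : Prime p) where

  private instance
    p≢0 : NonZero p
    p≢0 = prime⇒nonZero p-prime

  p≢1 : p ≢ 1
  p≢1 = nonTrivial⇒≢1 {{prime⇒nonTrivial p-prime}}

  ¬p∣! : ∀ {k} → k < p → ¬ p ∣ k !
  ¬p∣! {zero}  _   p∣1 = p≢1 (∣1⇒≡1 p∣1)
  ¬p∣! {suc k} k<p p∣k! with euclidsLemma (suc k) (k !) p-prime p∣k!
  ... | inj₁ p∣k = <⇒≱ k<p (∣⇒≤ p∣k)
  ... | inj₂ p∣k! = ¬p∣! (<-trans (n<1+n k) k<p) p∣k!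

  p∣pCk : ∀ {k} → 0 < k → k < p → p ∣ p C k
  p∣pCk {k} 0<k k<p with euclidsLemma (p C k) (k ! * (p ∸ k) !) p-prime p∣pCk*k![p∸k]!
    where
    instance _ = k !* (p ∸ k) !≢0
    p∣pCk*k![p∸k]! : p ∣ (p C k) * (k ! * (p ∸ k) !)
    p∣pCk*k![p∸k]! = subst (p ∣_) (sym pCk*k![p∸k]!≡p!) (n∣n! p)
      where
      pCk*k![p∸k]!≡p! : (p C k) * (k ! * (p ∸ k) !) ≡ p !
      pCk*k![p∸k]!≡p! = trans (cong (_* (k ! * (p ∸ k) !)) (nCk≡n!/k![n-k]! (<⇒≤ k<p))) (m/n*n≡m (k![n∸k]!∣n! (<⇒≤ k<p)))
  ... | inj₁ p∣pCk = p∣pCk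
  ... | inj₂ p∣k![p∸k]! with euclidsLemma (k !) ((p ∸ k) !) p-prime p∣k![p∸k]!
  ...   | inj₁ p∣k! = ⊥-elim (¬p∣! k<p p∣k!)
  ...   | inj₂ p∣[p∸k]! = ⊥-elim (¬p∣! (∸-monoʳ-< 0<k (<⇒≤ k<p)) p∣[p∸k]!)

  coprime-p^k⇒∤ : ∀ {x k} → Coprime x (p ^ suc k) → ¬ p ∣ x
  coprime-p^k⇒∤ {k = k} x⊥p^k+1 p∣x = p≢1 (x⊥p^k+1 (p∣x , m∣m*n (p ^ k)))

  ^≢1-mod⇒pred-coprime : ∀ {r i} k → ¬ p ∣ r → ¬ r ^ i ≡ 1 [mod p ] → ∃ λ h → r ^ i ≡ suc h × Coprime h (p ^ k)
  ^≢1-mod⇒pred-coprime {r} {i} k p∤r rⁱ≢1 with r ^ i in rⁱ≡x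
  ... | zero  = ⊥-elim (p∤r (subst (p ∣_) (sym (m^n≡0⇒m≡0 r i rⁱ≡x)) (p ∣0)))
  ... | suc h = h , refl , coprime-^ʳ (prime∤⇒coprime p-prime λ p∣h → rⁱ≢1 (∣⇒+-≡-mod 1 p∣h)) k

  [x+1]^p≡x^p+1 : ∀ x → (x + 1) ^ p ≡ x ^ p + 1 [mod p ]
  [x+1]^p≡x^p+1 x = subst (λ n → (x + 1) ^ n ≡ x ^ n + 1 [mod p ]) (suc-pred p)
    ([x+1]^[1+n]≡x^[1+n]+1 (pred p) p∣middle x)
    where
    p∣middle : ∀ {k} → 0 < k → k < suc (pred p) → p ∣ suc (pred p) C k
    p∣middle {k} 0<k k<p = subst (λ n → p ∣ n C k) (sym (suc-pred p)) (p∣pCk 0<k (subst (k <_) (suc-pred p) k<p))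

  fermat : ∀ x → x ^ p ≡ x [mod p ]
  fermat zero    = ≡-mod-reflexive (subst (λ n → 0 ^ n ≡ 0) (suc-pred p) refl)
  fermat (suc x) = begin
    suc x ^ p     ≡⟨ cong (_^ p) (+-comm 1 x) ⟩
    (x + 1) ^ p   ≈⟨ [x+1]^p≡x^p+1 x ⟩
    x ^ p + 1     ≈⟨ +-cong-mod (fermat x) (≡-mod-reflexive refl) ⟩
    x + 1         ≡⟨ +-comm x 1 ⟩
    suc x         ∎
    where open ≡-mod-Reasoning p

  fermat-unit : ∀ {r} → ¬ p ∣ r → r ^ (p ∸ 1) ≡ 1 [mod p ]
  fermat-unit {r} p∤r with r ^ (p ∸ 1) in eq
  ... | zero  = ⊥-elim (p∤r (subst (p ∣_) (sym (m^n≡0⇒m≡0 r (p ∸ 1) eq)) (p ∣0)))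
  ... | suc h = ∣⇒+-≡-mod 1 (p∣h (euclidsLemma r h p-prime (+-cancelˡ-≡-mod r r+rh≡r)))
    where
    r+rh≡r : r + r * h ≡ r [mod p ]
    r+rh≡r = begin
      r + r * h             ≡⟨ *-suc r h ⟨
      r * suc h             ≡⟨ cong (r *_) eq ⟨
      r ^ suc (pred p)      ≡⟨ cong (r ^_) (suc-pred p) ⟩
      r ^ p                 ≈⟨ fermat r ⟩
      r                     ∎
      where open ≡-mod-Reasoning p
    p∣h : p ∣ r ⊎ p ∣ h → p ∣ h
    p∣h (inj₁ p∣r) = ⊥-elim (p∤r p∣r)
    p∣h (inj₂ p∣h) = p∣h

  ≡1-mod-p^k⇒^p≡1-mod-p^k+1 : ∀ {k x} → x ≡ 1 [mod p ^ suc k ] → x ^ p ≡ 1 [mod p ^ suc (suc k) ]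
  ≡1-mod-p^k⇒^p≡1-mod-p^k+1 {k} {zero} 0≡1 =
    ⊥-elim (p≢1 (∣1⇒≡1 (∣-trans (m∣m*n (p ^ k)) (≡-mod⇒∣∸ (≡-mod-sym 0≡1)))))
  ≡1-mod-p^k⇒^p≡1-mod-p^k+1 {k} {suc h} h+1≡1 =
    ≡-mod-trans (≡-mod-reflexive (suc^≡1+*geometricSum h p)) (∣⇒+-≡-mod 1 p^k+2∣h*G)
    where
    G = geometricSum (suc h) p
    p∣G : p ∣ G
    p∣G = ≡0-mod⇒∣ (≡-mod-trans (geometricSum-≡-mod (≡-mod-divisor (m∣m*n (p ^ k)) h+1≡1) p) (∣⇒≡0-mod ∣-refl))
    p^k+2∣h*G : p ^ suc (suc k) ∣ h * G
    p^k+2∣h*G = subst (p ^ suc (suc k) ∣_) (*-comm G h) (*-pres-∣ p∣G (+-cancelˡ-≡-mod 1 h+1≡1))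

  euler : ∀ {r} → ¬ p ∣ r → ∀ e → r ^ (p ^ e * (p ∸ 1)) ≡ 1 [mod p ^ suc e ]
  euler {r} p∤r zero    = ≡-mod-trans (≡-mod-reflexive (cong (r ^_) (*-identityˡ (p ∸ 1))))
                                (≡-mod-divisor (∣-reflexive (*-identityʳ p)) (fermat-unit p∤r))
  euler {r} p∤r (suc e) = ≡-mod-trans (≡-mod-reflexive r^[p^e+1*[p-1]]≡[r^[p^e*[p-1]]]^p)
                                (≡1-mod-p^k⇒^p≡1-mod-p^k+1 {e} (euler p∤r e))
    where
    r^[p^e+1*[p-1]]≡[r^[p^e*[p-1]]]^p : r ^ (p ^ suc e * (p ∸ 1)) ≡ (r ^ (p ^ e * (p ∸ 1))) ^ p
    r^[p^e+1*[p-1]]≡[r^[p^e*[p-1]]]^p = trans (cong (r ^_) (trans (*-assoc p (p ^ e) (p ∸ 1)) (*-comm p _)))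
                                              (sym (^-*-assoc r (p ^ e * (p ∸ 1)) p))

  module _ {e r : ℕ} (5≤p : 5 ≤ p)
           (r-generates : ∀ x → Coprime x (p ^ suc e) → ∃ λ t → r ^ t ≡ x [mod p ^ suc e ]) where

    generator⇒r²≢1 : ¬ r ^ 2 ≡ 1 [mod p ]
    generator⇒r²≢1 r²≡1 = p∤ (s≤s z≤n) (≤-trans (s≤s (s≤s z≤n)) 5≤p) (≡-mod⇒∣∸ 3≡2)
      where
      p∤ : ∀ {d} → 0 < d → d < p → ¬ p ∣ d
      p∤ 0<d d<p p∣d = <⇒≱ d<p (∣⇒≤ {{>-nonZero 0<d}} p∣d)

      powers : ∀ t → r ^ t ≡ 1 [mod p ] ⊎ r ^ t ≡ r [mod p ]
      powers zero    = inj₁ (≡-mod-reflexive refl)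
      powers (suc t) with powers t
      ... | inj₁ rᵗ≡1 = inj₂ (≡-mod-trans (*-cong-mod {x = r} (≡-mod-reflexive refl) rᵗ≡1) (≡-mod-reflexive (*-identityʳ r)))
      ... | inj₂ rᵗ≡r = inj₁ (≡-mod-trans (*-cong-mod {x = r} (≡-mod-reflexive refl) rᵗ≡r)
                                          (≡-mod-trans (≡-mod-reflexive (cong (r *_) (sym (*-identityʳ r)))) r²≡1))

      residue≡r : ∀ x → 1 < x → x < p → x ≡ r [mod p ]
      residue≡r x 1<x x<p with r-generates x (coprime-^ʳ x⊥p (suc e))
        where
        x⊥p : Coprime x p
        x⊥p = Coprime.sym (prime⇒coprime p-prime {{>-nonZero (<-trans (s≤s z≤n) 1<x)}} x<p)
      ... | t , rᵗ≡x with powers t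
      ...   | inj₁ rᵗ≡1 = ⊥-elim (p∤ (m<n⇒0<n∸m 1<x) (≤-<-trans (m∸n≤m x 1) x<p) (≡-mod⇒∣∸ x≡1))
        where
        x≡1 : x ≡ 1 [mod p ]
        x≡1 = ≡-mod-trans (≡-mod-sym (≡-mod-divisor (m∣m*n (p ^ e)) rᵗ≡x)) rᵗ≡1
      ...   | inj₂ rᵗ≡r = ≡-mod-trans (≡-mod-sym (≡-mod-divisor (m∣m*n (p ^ e)) rᵗ≡x)) rᵗ≡r

      3≡2 : 3 ≡ 2 [mod p ]
      3≡2 = ≡-mod-trans (residue≡r 3 (s≤s (s≤s z≤n)) (≤-trans (s≤s (s≤s (s≤s (s≤s z≤n)))) 5≤p))
                        (≡-mod-sym (residue≡r 2 (s≤s (s≤s z≤n)) (≤-trans (s≤s (s≤s (s≤s z≤n))) 5≤p)))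

¬2∣⇒%2≡1 : ∀ {x} → ¬ 2 ∣ x → x % 2 ≡ 1
¬2∣⇒%2≡1 {x} 2∤x with x % 2 | m%n<n x 2 | m%n≡0⇒n∣m x 2
... | zero  | _             | 2∣x = ⊥-elim (2∤x (2∣x refl))
... | suc zero | _          | _   = refl
... | suc (suc _) | s≤s (s≤s ()) | _

%4≡1⇒2∣/2 : ∀ x → x % 4 ≡ 1 → 2 ∣ x / 2
%4≡1⇒2∣/2 x x%4≡1 = m%n≡0⇒n∣m (x / 2) 2 (trans (sym (m%[n*o]/o≡m/o%n x 2 2)) (cong (_/ 2) x%4≡1))

%4≡3⇒2∤/2 : ∀ x → x % 4 ≡ 3 → ¬ 2 ∣ x / 2
%4≡3⇒2∤/2 x x%4≡3 2∣x/2 = 0≢1+n (trans (sym (n∣m⇒m%n≡0 (x / 2) 2 2∣x/2))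
                                        (trans (sym (m%[n*o]/o≡m/o%n x 2 2)) (cong (_/ 2) x%4≡3)))

prime∣^⇒∣ : ∀ {q x} → Prime q → ∀ k → q ∣ x ^ k → q ∣ x
prime∣^⇒∣ q-prime zero    q∣1 = ⊥-elim (nonTrivial⇒≢1 {{prime⇒nonTrivial q-prime}} (∣1⇒≡1 q∣1))
prime∣^⇒∣ {x = x} q-prime (suc k) q∣xᵏ⁺¹ with euclidsLemma x (x ^ k) q-prime q∣xᵏ⁺¹
... | inj₁ q∣x  = q∣x
... | inj₂ q∣xᵏ = prime∣^⇒∣ q-prime k q∣xᵏ

module _ {n n₂ j : ℕ} (n₂+n₂≡n : n₂ + n₂ ≡ n) (j⊥n : Coprime j n) where

  private
    n≡n₂*2 : n ≡ n₂ * 2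
    n≡n₂*2 = trans (sym n₂+n₂≡n) (trans (cong (n₂ +_) (sym (+-identityʳ n₂))) (*-comm 2 n₂))

    2∤j : ¬ 2 ∣ j
    2∤j 2∣j with j⊥n (2∣j , divides n₂ n≡n₂*2)
    ... | ()

  ∣[j+n₂]⇒∣n⇒∣2 : ∀ {d} → d ∣ j + n₂ → d ∣ n → d ∣ 2
  ∣[j+n₂]⇒∣n⇒∣2 {d} d∣j+n₂ d∣n = coprime-divisor d⊥j (∣m+n∣m⇒∣n d∣2j+n d∣n)
    where
    d⊥j : Coprime d j
    d⊥j (i∣d , i∣j) = j⊥n (i∣j , ∣-trans i∣d d∣n)
    d∣2j+n : d ∣ n + j * 2
    d∣2j+n = subst (d ∣_) (trans (twice j n₂) (cong (_+ j * 2) n₂+n₂≡n)) (∣m∣n⇒∣m+n d∣j+n₂ d∣j+n₂)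
      where
      twice : ∀ j n₂ → j + n₂ + (j + n₂) ≡ n₂ + n₂ + j * 2
      twice = solve-∀

  ^[j+n₂]≢1 : ∀ {q r} → r ^ n ≡ 1 [mod q ] → ¬ r ^ 2 ≡ 1 [mod q ] → ¬ r ^ (j + n₂) ≡ 1 [mod q ]
  ^[j+n₂]≢1 {q} {r} rⁿ≡1 r²≢1 r^[j+n₂]≡1 with ∣[j+n₂]⇒∣n⇒∣2 (gcd[m,n]∣m (j + n₂) n) (gcd[m,n]∣n (j + n₂) n)
  ... | divides c 2≡c*g = r²≢1 (^-≡1-linear {s = 0} {t = c} {u = g} (trans (+-identityʳ 2) 2≡c*g) rᵍ≡1 rᵍ≡1)
    where
    g = gcd (j + n₂) n
    rᵍ≡1 : r ^ g ≡ 1 [mod q ]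
    rᵍ≡1 = ^-≡1-gcd {A = j + n₂} {B = n} r^[j+n₂]≡1 rⁿ≡1

  n∣*[j+n₂]⇔n∣ : 2 ∣ n₂ → ∀ u → n ∣ u * (j + n₂) ⇔ n ∣ u
  n∣*[j+n₂]⇔n∣ 2∣n₂ u = mk⇔ (λ n∣u*I → coprime-divisor (Coprime.sym I⊥n) (subst (n ∣_) (*-comm u _) n∣u*I))
                              (∣m⇒∣m*n (j + n₂))
    where
    I⊥n : Coprime (j + n₂) n
    I⊥n {d} (d∣I , d∣n) with prime⇒irreducible prime[2] (∣[j+n₂]⇒∣n⇒∣2 d∣I d∣n)
    ... | inj₁ d≡1 = d≡1
    ... | inj₂ refl = ⊥-elim (2∤j (∣m+n∣m⇒∣n (subst (2 ∣_) (+-comm j n₂) d∣I) 2∣n₂))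

  n∣*[j+n₂]⇔n₂∣ : ¬ 2 ∣ n₂ → ∀ u → n ∣ u * (j + n₂) ⇔ n₂ ∣ u
  n∣*[j+n₂]⇔n₂∣ 2∤n₂ u = mk⇔
    (λ n∣u*[j+n₂] → coprime-divisor (Coprime.sym I⊥n₂)
                      (subst (n₂ ∣_) (*-comm u I) (*-cancelʳ-∣ 2 (subst₂ _∣_ n≡n₂*2 u*[j+n₂]≡u*I*2 n∣u*[j+n₂]))))
    (λ n₂∣u → subst₂ _∣_ (sym n≡n₂*2) (sym u*[j+n₂]≡u*I*2) (*-monoˡ-∣ 2 (∣m⇒∣m*n I n₂∣u)))
    where
    2∣j+n₂ : 2 ∣ j + n₂
    2∣j+n₂ = m%n≡0⇒n∣m (j + n₂) 2
      (trans (%-distribˡ-+ j n₂ 2) (cong₂ (λ s t → (s + t) % 2) (¬2∣⇒%2≡1 2∤j) (¬2∣⇒%2≡1 2∤n₂)))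
    I = (j + n₂) / 2
    j+n₂≡I*2 : j + n₂ ≡ I * 2
    j+n₂≡I*2 = sym (m/n*n≡m 2∣j+n₂)
    u*[j+n₂]≡u*I*2 : u * (j + n₂) ≡ u * I * 2
    u*[j+n₂]≡u*I*2 = trans (cong (u *_) j+n₂≡I*2) (sym (*-assoc u I 2))
    I⊥n₂ : Coprime I n₂
    I⊥n₂ {d} (d∣I , d∣n₂) = ∣1⇒≡1 (*-cancelʳ-∣ 2 (∣[j+n₂]⇒∣n⇒∣2 d*2∣j+n₂ d*2∣n))
      where
      d*2∣j+n₂ : d * 2 ∣ j + n₂
      d*2∣j+n₂ = subst (d * 2 ∣_) (sym j+n₂≡I*2) (*-monoˡ-∣ 2 d∣I)
      d*2∣n : d * 2 ∣ n
      d*2∣n = subst (d * 2 ∣_) (sym n≡n₂*2) (*-monoˡ-∣ 2 d∣n₂)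

module Presentation (n m r : ℕ) .{{_ : NonZero n}} .{{_ : NonZero m}} (rⁿ≡1 : r ^ n ≡ 1 [mod m ]) where

  open Meta n m r

  el : ℕ → ℕ → El
  el i k = (i mod n , k mod m)

  r^[i+an]≡r^i : ∀ i a → r ^ (i + a * n) ≡ r ^ i [mod m ]
  r^[i+an]≡r^i i a = begin
    r ^ (i + a * n)       ≡⟨ ^-distribˡ-+-* r i (a * n) ⟩
    r ^ i * r ^ (a * n)   ≡⟨ cong (λ k → r ^ i * r ^ k) (*-comm a n) ⟩
    r ^ i * r ^ (n * a)   ≡⟨ cong (r ^ i *_) (^-*-assoc r n a) ⟨
    r ^ i * (r ^ n) ^ a   ≈⟨ *-cong-mod {x = r ^ i} (≡-mod-reflexive refl) (≡1⇒^≡1 rⁿ≡1 a) ⟩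
    r ^ i * 1             ≡⟨ *-identityʳ (r ^ i) ⟩
    r ^ i                 ∎
    where open ≡-mod-Reasoning m

  r^-cong : ∀ {i i′} → i ≡ i′ [mod n ] → r ^ i ≡ r ^ i′ [mod m ]
  r^-cong {i} {i′} (congruent a b i+an≡i′+bn) =
    ≡-mod-trans (≡-mod-sym (r^[i+an]≡r^i i a)) (≡-mod-trans (≡-mod-reflexive (cong (r ^_) i+an≡i′+bn)) (r^[i+an]≡r^i i′ b))

  toℕ-mod : ∀ {q} .{{_ : NonZero q}} i → toℕ (i mod q) ≡ i [mod q ]
  toℕ-mod {q} i = ≡-mod-trans (≡-mod-reflexive (toℕ-fromℕ< (m%n<n i q))) (%-≡-mod i)

  el-cong : ∀ {i i′ k k′} → i ≡ i′ [mod n ] → k ≡ k′ [mod m ] → el i k ≡ el i′ k′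
  el-cong {i} {i′} {k} {k′} i≡i′ k≡k′ =
    cong₂ _,_ (fromℕ<-cong _ _ (≡-mod⇒%≡% i≡i′) (m%n<n i n) (m%n<n i′ n))
              (fromℕ<-cong _ _ (≡-mod⇒%≡% k≡k′) (m%n<n k m) (m%n<n k′ m))

  el-injective : ∀ {i i′ k k′} → el i k ≡ el i′ k′ → i ≡ i′ [mod n ] × k ≡ k′ [mod m ]
  el-injective {i} {i′} {k} {k′} eq =
    ≡-mod-trans (≡-mod-sym (toℕ-mod i)) (≡-mod-trans (≡-mod-reflexive (cong (toℕ ∘ proj₁) eq)) (toℕ-mod i′)) ,
    ≡-mod-trans (≡-mod-sym (toℕ-mod k)) (≡-mod-trans (≡-mod-reflexive (cong (toℕ ∘ proj₂) eq)) (toℕ-mod k′))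

  el-toℕ : ∀ x → el (toℕ (proj₁ x)) (toℕ (proj₂ x)) ≡ x
  el-toℕ (i , k) = cong₂ _,_ (mod-toℕ i) (mod-toℕ k)
    where
    mod-toℕ : ∀ {q} .{{_ : NonZero q}} (i : Fin q) → toℕ i mod q ≡ i
    mod-toℕ {q} i = trans (fromℕ<-cong _ _ (m<n⇒m%n≡m (toℕ<n i)) (m%n<n (toℕ i) q) (toℕ<n i)) (fromℕ<-toℕ i (toℕ<n i))

  el-· : ∀ i k i′ k′ → el i k · el i′ k′ ≡ el (i + i′) (k * r ^ i′ + k′)
  el-· i k i′ k′ = el-cong (+-cong-mod (toℕ-mod i) (toℕ-mod i′))
                           (+-cong-mod (*-cong-mod (toℕ-mod k) (r^-cong (toℕ-mod i′))) (toℕ-mod k′))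

  pow-el : ∀ i k t → pow (el i k) t ≡ el (t * i) (k * geometricSum (r ^ i) t)
  pow-el i k zero    = cong (el 0) (sym (*-zeroʳ k))
  pow-el i k (suc t) = begin
    el i k · pow (el i k) t                         ≡⟨ cong (el i k ·_) (pow-el i k t) ⟩
    el i k · el (t * i) (k * G)                     ≡⟨ el-· i k (t * i) (k * G) ⟩
    el (i + t * i) (k * r ^ (t * i) + k * G)        ≡⟨ cong (λ e → el (i + t * i) (k * r ^ e + k * G)) (*-comm t i) ⟩
    el (i + t * i) (k * r ^ (i * t) + k * G)        ≡⟨ cong (λ x → el (i + t * i) (k * x + k * G)) (^-*-assoc r i t) ⟨
    el (i + t * i) (k * (r ^ i) ^ t + k * G)        ≡⟨ cong (el (i + t * i)) (*-distribˡ-+ k ((r ^ i) ^ t) G) ⟨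
    el (i + t * i) (k * ((r ^ i) ^ t + G))          ∎
    where
    open ≡-Reasoning
    G = geometricSum (r ^ i) t

  ·-identityˡ : ∀ x → one · x ≡ x
  ·-identityˡ x = trans (cong (one ·_) (sym (el-toℕ x)))
                        (trans (el-· 0 0 (toℕ (proj₁ x)) (toℕ (proj₂ x))) (el-toℕ x))

  ·-identityʳ : ∀ x → x · one ≡ x
  ·-identityʳ x = begin
    x · one                          ≡⟨ cong (_· one) (el-toℕ x) ⟨
    el i k · el 0 0                  ≡⟨ el-· i k 0 0 ⟩
    el (i + 0) (k * 1 + 0)           ≡⟨ cong₂ el (+-identityʳ i) (trans (+-identityʳ (k * 1)) (*-identityʳ k)) ⟩
    el i k                           ≡⟨ el-toℕ x ⟩
    x                                ∎
    where
    open ≡-Reasoning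
    i = toℕ (proj₁ x)
    k = toℕ (proj₂ x)

  module _ {φ : El → El} (φ-aut : IsAut φ) where

    private
      φ-hom : ∀ x y → φ (x · y) ≡ φ x · φ y
      φ-hom = proj₂ φ-aut

    aut-one : φ one ≡ one
    aut-one with proj₂ (proj₁ φ-aut) one
    ... | y , φy≡one = begin
      φ one              ≡⟨ ·-identityʳ (φ one) ⟨
      φ one · one        ≡⟨ cong (φ one ·_) (φy≡one refl) ⟨
      φ one · φ y        ≡⟨ φ-hom one y ⟨
      φ (one · y)        ≡⟨ cong φ (·-identityˡ y) ⟩
      φ y                ≡⟨ φy≡one refl ⟩
      one                ∎
      where open ≡-Reasoning

    aut-pow : ∀ x t → φ (pow x t) ≡ pow (φ x) t
    aut-pow x zero    = aut-one
    aut-pow x (suc t) = trans (φ-hom x (pow x t)) (cong (φ x ·_) (aut-pow x t))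

  IsOrder-∣ : ∀ {x T} → 0 < T → (∀ u → pow x u ≡ one ⇔ T ∣ u) → IsOrder x T
  IsOrder-∣ {x} {T} 0<T xᵘ≡1⇔T∣u =
    0<T , Equivalence.from (xᵘ≡1⇔T∣u T) ∣-refl ,
    λ u 0<u xᵘ≡1 → ∣⇒≤ {{>-nonZero 0<u}} (Equivalence.to (xᵘ≡1⇔T∣u u) xᵘ≡1)

  pow-el[i,0]≡one⇔ : ∀ i u → pow (el i 0) u ≡ one ⇔ n ∣ u * i
  pow-el[i,0]≡one⇔ i u = mk⇔
    (λ eq → ≡0-mod⇒∣ (proj₁ (el-injective (trans (sym (pow-el i 0 u)) eq))))
    (λ n∣ui → trans (pow-el i 0 u) (el-cong (∣⇒≡0-mod n∣ui) (≡-mod-reflexive refl)))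

  pow-el[i,1]≡one⇔ : ∀ {i h} → r ^ i ≡ suc h → Coprime h m → ∀ u → pow (el i 1) u ≡ one ⇔ n ∣ u * i
  pow-el[i,1]≡one⇔ {i} {h} rⁱ≡1+h h⊥m u = mk⇔
    (λ eq → ≡0-mod⇒∣ (proj₁ (el-injective (trans (sym (pow-el i 1 u)) eq))))
    (λ n∣ui → trans (pow-el i 1 u) (el-cong (∣⇒≡0-mod n∣ui) (∣⇒≡0-mod (m∣G n∣ui))))
    where
    G = geometricSum (r ^ i) u
    m∣G : n ∣ u * i → m ∣ 1 * G
    m∣G n∣ui = subst (m ∣_) (sym (*-identityˡ G)) (coprime-divisor (Coprime.sym h⊥m) (+-cancelˡ-≡-mod 1 1+hG≡1))
      where
      1+hG≡1 : 1 + h * G ≡ 1 [mod m ]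
      1+hG≡1 = begin
        suc (h * G)                         ≡⟨ cong (λ g → suc (h * geometricSum g u)) rⁱ≡1+h ⟩
        suc (h * geometricSum (suc h) u)    ≡⟨ suc^≡1+*geometricSum h u ⟨
        suc h ^ u                           ≡⟨ cong (_^ u) rⁱ≡1+h ⟨
        (r ^ i) ^ u                         ≡⟨ ^-*-assoc r i u ⟩
        r ^ (i * u)                         ≈⟨ r^-cong (∣⇒≡0-mod (subst (n ∣_) (*-comm u i) n∣ui)) ⟩
        1                                   ∎
        where open ≡-mod-Reasoning m

  pow-a : ∀ t → pow a t ≡ el t 0
  pow-a t = trans (pow-el 1 0 t) (cong (λ i → el i 0) (*-identityʳ t))

  order-a^j : ∀ {j} → Coprime j n → IsOrder (pow a j) n
  order-a^j {j} j⊥n = IsOrder-∣ (>-nonZero⁻¹ n) λ u → mk⇔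
    (λ eq → coprime-divisor (Coprime.sym j⊥n) (subst (n ∣_) (*-comm u j)
              (Equivalence.to (pow-el[i,0]≡one⇔ j u) (trans (cong (λ x → pow x u) (sym (pow-a j))) eq))))
    (λ n∣u → trans (cong (λ x → pow x u) (pow-a j)) (Equivalence.from (pow-el[i,0]≡one⇔ j u) (∣m⇒∣m*n j n∣u)))

  module _ (n₂ : ℕ) (n₂+n₂≡n : n₂ + n₂ ≡ n) where

    b≡el : pow a n₂ · c ≡ el n₂ 1
    b≡el = trans (cong (_· c) (pow-a n₂)) (trans (el-· n₂ 0 0 1) (cong (λ i → el i 1) (+-identityʳ n₂)))

    a^j·b≡el : ∀ j → pow a j · (pow a n₂ · c) ≡ el (j + n₂) 1
    a^j·b≡el j = trans (cong₂ _·_ (pow-a j) b≡el) (el-· j 0 n₂ 1)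

    order-a^j·b : ∀ {j T} → (∃ λ h → r ^ (j + n₂) ≡ suc h × Coprime h m) → 0 < T →
                  (∀ u → n ∣ u * (j + n₂) ⇔ T ∣ u) → IsOrder (pow a j · (pow a n₂ · c)) T
    order-a^j·b {j} {T} (h , r^[j+n₂]≡1+h , h⊥m) 0<T n∣⇔T∣ = subst (λ x → IsOrder x T) (sym (a^j·b≡el j))
      (IsOrder-∣ 0<T λ u → n∣⇔T∣ u ⇔-∘ pow-el[i,1]≡one⇔ r^[j+n₂]≡1+h h⊥m u)

    MapIso[a^j,a^-j]⇒r²≡1 : ∀ {j} → Coprime j n → j ≤ n →
                            MapIso (pow a j) (pow a n₂ · c) (pow a (n ∸ j)) (pow a n₂ · c) → r ^ 2 ≡ 1 [mod m ]
    MapIso[a^j,a^-j]⇒r²≡1 {j} j⊥n j≤n (φ , φ-aut , φa^j≡a^-j , φb≡b) = r²≡1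
      where
      b = pow a n₂ · c
      k = proj₁ (inverse-mod n j⊥n)
      -- i ≡ -1 (mod n), and φ a = a^i
      i = k * (n ∸ j)

      1+i≡0 : 1 + i ≡ 0 [mod n ]
      1+i≡0 = begin
        1 + i                  ≈⟨ +-cong-mod (≡-mod-sym (proj₂ (inverse-mod n j⊥n))) (≡-mod-reflexive {x = i} refl) ⟩
        k * j + k * (n ∸ j)    ≡⟨ *-distribˡ-+ k j (n ∸ j) ⟨
        k * (j + (n ∸ j))      ≡⟨ cong (k *_) (m+[n∸m]≡n j≤n) ⟩
        k * n                  ≈⟨ ∣⇒≡0-mod (n∣m*n k) ⟩
        0                      ∎
        where open ≡-mod-Reasoning n

      a≡[a^j]^k : a ≡ pow (pow a j) k
      a≡[a^j]^k = sym (begin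
        pow (pow a j) k        ≡⟨ cong (λ x → pow x k) (pow-a j) ⟩
        pow (el j 0) k         ≡⟨ pow-el j 0 k ⟩
        el (k * j) 0           ≡⟨ el-cong (proj₂ (inverse-mod n j⊥n)) (≡-mod-reflexive refl) ⟩
        a                      ∎)
        where open ≡-Reasoning

      φa≡el : φ a ≡ el i 0
      φa≡el = begin
        φ a                    ≡⟨ cong φ a≡[a^j]^k ⟩
        φ (pow (pow a j) k)    ≡⟨ aut-pow φ-aut (pow a j) k ⟩
        pow (φ (pow a j)) k    ≡⟨ cong (λ x → pow x k) (trans φa^j≡a^-j (pow-a (n ∸ j))) ⟩
        pow (el (n ∸ j) 0) k   ≡⟨ pow-el (n ∸ j) 0 k ⟩
        el i 0                 ∎
        where open ≡-Reasoning
      c≡a^n₂·b : c ≡ pow a n₂ · b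
      c≡a^n₂·b = sym (begin
        pow a n₂ · b           ≡⟨ cong₂ _·_ (pow-a n₂) b≡el ⟩
        el n₂ 0 · el n₂ 1      ≡⟨ el-· n₂ 0 n₂ 1 ⟩
        el (n₂ + n₂) 1         ≡⟨ el-cong (≡-mod-trans (≡-mod-reflexive n₂+n₂≡n) (∣⇒≡0-mod ∣-refl)) (≡-mod-reflexive refl) ⟩
        c                      ∎)
        where open ≡-Reasoning

      n₂*i+n₂≡0 : n₂ * i + n₂ ≡ 0 [mod n ]
      n₂*i+n₂≡0 = begin
        n₂ * i + n₂            ≡⟨ trans (+-comm (n₂ * i) n₂) (sym (*-suc n₂ i)) ⟩
        n₂ * (1 + i)           ≈⟨ *-cong-mod {x = n₂} (≡-mod-reflexive refl) 1+i≡0 ⟩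
        n₂ * 0                 ≡⟨ *-zeroʳ n₂ ⟩
        0                      ∎
        where open ≡-mod-Reasoning n

      φc≡c : φ c ≡ c
      φc≡c = begin
        φ c                    ≡⟨ cong φ c≡a^n₂·b ⟩
        φ (pow a n₂ · b)       ≡⟨ proj₂ φ-aut (pow a n₂) b ⟩
        φ (pow a n₂) · φ b     ≡⟨ cong₂ _·_ (trans (aut-pow φ-aut a n₂) (cong (λ x → pow x n₂) φa≡el)) (trans φb≡b b≡el) ⟩
        pow (el i 0) n₂ · el n₂ 1  ≡⟨ cong (_· el n₂ 1) (pow-el i 0 n₂) ⟩
        el (n₂ * i) 0 · el n₂ 1    ≡⟨ el-· (n₂ * i) 0 n₂ 1 ⟩
        el (n₂ * i + n₂) 1     ≡⟨ el-cong n₂*i+n₂≡0 (≡-mod-reflexive refl) ⟩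
        c                      ∎
        where open ≡-Reasoning
      c^r≡el : pow c r ≡ el 0 r
      c^r≡el = trans (pow-el 0 1 r) (cong₂ el (*-zeroʳ r) (trans (*-identityˡ _) (geometricSum[1,t]≡t r)))

      ca≡ac^r : c · a ≡ a · pow c r
      ca≡ac^r = begin
        c · a                  ≡⟨ el-· 0 1 1 0 ⟩
        el 1 (1 * r ^ 1 + 0)   ≡⟨ cong (el 1) (trans (+-identityʳ (1 * r ^ 1))
                                         (trans (*-identityˡ (r ^ 1)) (*-identityʳ r))) ⟩
        el 1 r                 ≡⟨ el-· 1 0 0 r ⟨
        a · el 0 r             ≡⟨ cong (a ·_) c^r≡el ⟨
        a · pow c r            ∎
        where open ≡-Reasoning

      r^i≡r : 1 * r ^ i + 0 ≡ r [mod m ]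
      r^i≡r = proj₂ (el-injective (begin
        el (0 + i) (1 * r ^ i + 0) ≡⟨ el-· 0 1 i 0 ⟨
        c · el i 0             ≡⟨ cong₂ _·_ φc≡c φa≡el ⟨
        φ c · φ a              ≡⟨ proj₂ φ-aut c a ⟨
        φ (c · a)              ≡⟨ cong φ ca≡ac^r ⟩
        φ (a · pow c r)        ≡⟨ proj₂ φ-aut a (pow c r) ⟩
        φ a · φ (pow c r)      ≡⟨ cong₂ _·_ φa≡el (trans (aut-pow φ-aut c r) (trans (cong (λ x → pow x r) φc≡c) c^r≡el)) ⟩
        el i 0 · el 0 r        ≡⟨ el-· i 0 0 r ⟩
        el (i + 0) r           ∎))
        where open ≡-Reasoning

      r²≡1 : r ^ 2 ≡ 1 [mod m ]
      r²≡1 = begin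
        r ^ 2                    ≡⟨ cong (r *_) (*-identityʳ r) ⟩
        r * r                    ≈⟨ *-cong-mod {x = r} (≡-mod-reflexive refl) r^i≡r ⟨
        r * (1 * r ^ i + 0)      ≡⟨ cong (r *_) (trans (+-identityʳ (1 * r ^ i)) (*-identityˡ (r ^ i))) ⟩
        r ^ suc i                ≈⟨ r^-cong 1+i≡0 ⟩
        1                        ∎
        where open ≡-mod-Reasoning m

module _ {p : ℕ} (p-prime : Prime p) (5≤p : 5 ≤ p) (e : ℕ) where

  private
    2∤p : ¬ 2 ∣ p
    2∤p 2∣p with prime⇒irreducible p-prime 2∣p
    ... | inj₂ refl = <⇒≱ (s≤s (s≤s (s≤s z≤n))) 5≤p

    N≡p^e*[p/2]*2 : N p e ≡ p ^ e * (p / 2) * 2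
    N≡p^e*[p/2]*2 = begin
      p ^ e * (p ∸ 1)                          ≡⟨ cong (λ x → p ^ e * (x ∸ 1)) (m≡m%n+[m/n]*n p 2) ⟩
      p ^ e * ((p % 2 + p / 2 * 2) ∸ 1)        ≡⟨ cong (λ s → p ^ e * ((s + p / 2 * 2) ∸ 1)) (¬2∣⇒%2≡1 2∤p) ⟩
      p ^ e * (p / 2 * 2)                      ≡⟨ *-assoc (p ^ e) (p / 2) 2 ⟨
      p ^ e * (p / 2) * 2                      ∎
      where open ≡-Reasoning

  N/2≡p^e*[p/2] : N p e / 2 ≡ p ^ e * (p / 2)
  N/2≡p^e*[p/2] = trans (cong (_/ 2) N≡p^e*[p/2]*2) (m*n/n≡m (p ^ e * (p / 2)) 2)

  N/2+N/2≡N : N p e / 2 + N p e / 2 ≡ N p e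
  N/2+N/2≡N = begin
    N p e / 2 + N p e / 2          ≡⟨ cong₂ _+_ N/2≡p^e*[p/2] N/2≡p^e*[p/2] ⟩
    p ^ e * (p / 2) + p ^ e * (p / 2)  ≡⟨ cong (p ^ e * (p / 2) +_) (+-identityʳ (p ^ e * (p / 2))) ⟨
    2 * (p ^ e * (p / 2))          ≡⟨ *-comm 2 (p ^ e * (p / 2)) ⟩
    p ^ e * (p / 2) * 2            ≡⟨ N≡p^e*[p/2]*2 ⟨
    N p e                          ∎
    where open ≡-Reasoning

  0<N/2 : 0 < N p e / 2
  0<N/2 = n≢0⇒n>0 λ N/2≡0 → ≢-nonZero⁻¹ (N p e) {{nzN e (≤-trans (s≤s (s≤s z≤n)) 5≤p)}}
                                        (trans (sym N/2+N/2≡N) (cong₂ _+_ N/2≡0 N/2≡0))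

  %4≡1⇒2∣N/2 : p % 4 ≡ 1 → 2 ∣ N p e / 2
  %4≡1⇒2∣N/2 p%4≡1 = subst (2 ∣_) (sym N/2≡p^e*[p/2]) (∣n⇒∣m*n (p ^ e) (%4≡1⇒2∣/2 p p%4≡1))

  %4≡3⇒2∤N/2 : p % 4 ≡ 3 → ¬ 2 ∣ N p e / 2
  %4≡3⇒2∤N/2 p%4≡3 2∣N/2 with euclidsLemma (p ^ e) (p / 2) prime[2] (subst (2 ∣_) N/2≡p^e*[p/2] 2∣N/2)
  ... | inj₁ 2∣p^e  = 2∤p (prime∣^⇒∣ prime[2] e 2∣p^e)
  ... | inj₂ 2∣p/2  = %4≡3⇒2∤/2 p p%4≡3 2∣p/2

lemma3p3 : (p e r : ℕ) → Prime p → (p5 : 5 ≤ p) → 1 ≤ e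
    → IsGenerator r (M p e) {{nzM e (≤-trans (s≤s (s≤s z≤n)) p5)}}
    → (j : ℕ) → j < N p e → Coprime j (N p e)
    → let open G1 p e r (≤-trans (s≤s (s≤s z≤n)) p5) in
      -- chiral: M_1(p,e,j) = M(G;a^j,b) is not isomorphic to M(G;a^(-j),b)
      ¬ MapIso (pow a j) b (pow a (N p e ∸ j)) b
      × (p % 4 ≡ 1 → HasType (pow a j) b (N p e) (N p e))
      × (p % 4 ≡ 3 → HasType (pow a j) b (N p e / 2) (N p e))
lemma3p3 p e r p-prime 5≤p _ (r⊥m , r-gen) j j<n j⊥n =
  (λ iso → r²≢1 (≡-mod-divisor p∣m (MapIso[a^j,a^-j]⇒r²≡1 n₂ n₂+n₂≡n j⊥n (<⇒≤ j<n) iso))) ,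
  (λ p%4≡1 → order-a^j·b n₂ n₂+n₂≡n r^[j+n₂]-1⊥m (>-nonZero⁻¹ n)
               (n∣*[j+n₂]⇔n∣ n₂+n₂≡n j⊥n (%4≡1⇒2∣N/2 p-prime 5≤p e p%4≡1)) , order-a^j j⊥n) ,
  (λ p%4≡3 → order-a^j·b n₂ n₂+n₂≡n r^[j+n₂]-1⊥m (0<N/2 p-prime 5≤p e)
               (n∣*[j+n₂]⇔n₂∣ n₂+n₂≡n j⊥n (%4≡3⇒2∤N/2 p-prime 5≤p e p%4≡3)) , order-a^j j⊥n)
  where
  2≤p : 2 ≤ p
  2≤p = ≤-trans (s≤s (s≤s z≤n)) 5≤p
  open G1 p e r 2≤p
  n = N p e
  m = M p e
  n₂ = N p e / 2
  instance
    n≢0 : NonZero n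
    n≢0 = nzN e 2≤p
    m≢0 : NonZero m
    m≢0 = nzM e 2≤p

  p∣m : p ∣ m
  p∣m = m∣m*n (p ^ e)
  p∤r : ¬ p ∣ r
  p∤r = coprime-p^k⇒∤ p-prime {k = e} r⊥m
  n₂+n₂≡n : n₂ + n₂ ≡ n
  n₂+n₂≡n = N/2+N/2≡N p-prime 5≤p e

  r²≢1 : ¬ r ^ 2 ≡ 1 [mod p ]
  r²≢1 = generator⇒r²≢1 p-prime {e} {r} 5≤p λ x x⊥m → proj₁ (r-gen x x⊥m) , %≡%⇒≡-mod (proj₂ (r-gen x x⊥m))
  rⁿ≡1 : r ^ n ≡ 1 [mod m ]
  rⁿ≡1 = euler p-prime p∤r e
  open Presentation n m r rⁿ≡1

  r^[j+n₂]-1⊥m : ∃ λ h → r ^ (j + n₂) ≡ suc h × Coprime h m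
  r^[j+n₂]-1⊥m = ^≢1-mod⇒pred-coprime p-prime {i = j + n₂} (suc e) p∤r (^[j+n₂]≢1 n₂+n₂≡n j⊥n (≡-mod-divisor p∣m rⁿ≡1) r²≢1)
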